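{- Let $S$ be a partial Sudoku of type $(h,w)$. For every $e\in E(G_S)$ we have $0\le (\Delta M\,\mathbf{1})(e)\le 4u(e)$. In particular, $\|\Delta M\|_\infty\le 4\|\mathbf{u}\|_\infty$.
   Context: Let $h,w\ge 2$, $n=hw$, $\mathrm{box}(i,j)=h\lfloor (i-1)/h\rfloor+\lfloor (j-1)/w\rfloor+1$. A partial Sudoku of type $(h,w)$ is an $n\times n$ array with cells empty or filled from $[n]$, each symbol at most once per row, column and box $\mathrm{box}^{ -1}(\ell)$. $G_{hw}$ has vertices $r_i,c_j,b_\ell,s_k$ and edges $\{r_i,c_j\},\{r_i,s_k\},\{c_j,s_k\},\{b_\ell,s_k\}$ ($i,j,k,\ell\in[n]$). A tile is the edge set $\{r_ic_j,r_is_k,c_js_k,b_\ell s_k\}$ with $\ell=\mathrm{box}(i,j)$; $T(G_{hw})$ is the set of all tiles. $W$ is the edge-versus-tile zero-one inclusion matrix of $G_{hw}$, $M=WW^\top$ (so $M(e,f)$ is the number of tiles containing both $e$ and $f$). $G_S$ is obtained from $G_{hw}$ by deleting the edges of the tile of $(i,j,k)$ for every filled cell $(i,j)$ with symbol $k$; $T(G_S)$ is the set of tiles with all edges in $G_S$; $M_S=W_SW_S^\top$ where $W_S$ is the inclusion matrix of $E(G_S)$ versus $T(G_S)$. Define the $4n^2\times 4n^2$ matrix $\widetilde M$ indexed by $E(G_{hw})$ by $\widetilde M(e,f)=M_S(e,f)$ if $e,f\in E(G_S)$; $\widetilde M(e,f)=0$ if $e\in E(G_S)$, $f\notin E(G_S)$;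 $\widetilde M(e,f)=M(e,f)$ if $e\notin E(G_S)$. Put $\Delta M=M-\widetilde M$. For $e\in E(G_S)$ let $u(e)$ be the number of tiles $t\in T(G_{hw})$ with $e\in t$ and $t$ containing some edge not in $E(G_S)$, and $\mathbf{u}=(u(e))_{e\in E(G_S)}$. $\|\cdot\|_\infty$ is the max-absolute-entry norm on vectors and the max absolute row sum norm on matrices; $\mathbf{1}$ is the all-ones vector. -}

module Defs where

open import Data.Nat as ℕ using (ℕ; zero; suc; _/_; NonZero; _⊔_)
open import Data.Integer as ℤ using (ℤ)
open import Data.Fin as Fin using (Fin; toℕ)
open import Data.Bool using (Bool; true; false; _∧_; _∨_; not; if_then_else_)
open import Data.Maybe using (Maybe; just)
open import Data.Product using (_×_; _,_)
open import Relation.Nullary using (does)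
open import Relation.Binary.PropositionalEquality using (_≡_)

foldFin : {A : Set} → (A → A → A) → A → (n : ℕ) → (Fin n → A) → A
foldFin _∙_ ε zero    f = ε
foldFin _∙_ ε (suc n) f = f Fin.zero ∙ foldFin _∙_ ε n (λ i → f (Fin.suc i))

sumℕ : (n : ℕ) → (Fin n → ℕ) → ℕ
sumℕ = foldFin ℕ._+_ 0

anyF : (n : ℕ) → (Fin n → Bool) → Bool
anyF = foldFin _∨_ false

eqF : {n : ℕ} → Fin n → Fin n → Bool
eqF a b = does (a Fin.≟ b)

-- Box of a cell, 0-based: box(i,j) = h ⌊i/h⌋ + ⌊j/w⌋  (paper's formula shifted by 1).
boxℕ : (h w : ℕ) .{{_ : NonZero h}} .{{_ : NonZero w}} → ℕ → ℕ → ℕ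
boxℕ h w i j = h ℕ.* (i / h) ℕ.+ (j / w)

record PartialSudoku (h w : ℕ) .{{_ : NonZero h}} .{{_ : NonZero w}} : Set where
  field
    cell : Fin (h ℕ.* w) → Fin (h ℕ.* w) → Maybe (Fin (h ℕ.* w))
    rowOK : ∀ i j j' k → cell i j ≡ just k → cell i j' ≡ just k → j ≡ j'
    colOK : ∀ i i' j k → cell i j ≡ just k → cell i' j ≡ just k → i ≡ i'
    boxOK : ∀ i j i' j' k →
            boxℕ h w (toℕ i) (toℕ j) ≡ boxℕ h w (toℕ i') (toℕ j') →
            cell i j ≡ just k → cell i' j' ≡ just k → (i ≡ i' × j ≡ j')
open PartialSudoku public

-- Edges of G_hw: r_i c_j, r_i s_k, c_j s_k, b_l s_k.
data Edge (n : ℕ) : Set where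
  rc : Fin n → Fin n → Edge n
  rs : Fin n → Fin n → Edge n
  cs : Fin n → Fin n → Edge n
  bs : Fin n → Fin n → Edge n

foldE : {A : Set} → (A → A → A) → A → (n : ℕ) → (Edge n → A) → A
foldE _∙_ ε n f =
  foldFin _∙_ ε n λ a → foldFin _∙_ ε n λ b →
    (f (rc a b) ∙ f (rs a b)) ∙ (f (cs a b) ∙ f (bs a b))

-- finite fold over all n^3 tiles, a tile being indexed by the triple (i,j,k)
foldT : {A : Set} → (A → A → A) → A → (n : ℕ) → (Fin n → Fin n → Fin n → A) → A
foldT _∙_ ε n f =
  foldFin _∙_ ε n λ i → foldFin _∙_ ε n λ j → foldFin _∙_ ε n λ k → f i j k

module _ (h w : ℕ) .{{_ : NonZero h}} .{{_ : NonZero w}} where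

  private
    n = h ℕ.* w

  inTile : Edge n → Fin n → Fin n → Fin n → Bool
  inTile (rc a b) i j k = eqF a i ∧ eqF b j
  inTile (rs a b) i j k = eqF a i ∧ eqF b k
  inTile (cs a b) i j k = eqF a j ∧ eqF b k
  inTile (bs l b) i j k = does (toℕ l ℕ.≟ boxℕ h w (toℕ i) (toℕ j)) ∧ eqF b k

  module _ (S : PartialSudoku h w) where

    filledWith : Fin n → Fin n → Fin n → Bool
    filledWith i j k with cell S i j
    ... | just k' = eqF k k'
    ... | _ = false

    deleted : Edge n → Bool
    deleted e = foldT _∨_ false n λ i j k → filledWith i j k ∧ inTile e i j k

    inGS : Edge n → Bool
    inGS e = not (deleted e)

    tileInGS : Fin n → Fin n → Fin n → Bool
    tileInGS i j k = not (foldE _∨_ false n λ e → inTile e i j k ∧ deleted e)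

  M : Edge n → Edge n → ℕ
  M e f = foldT ℕ._+_ 0 n λ i j k → if inTile e i j k ∧ inTile f i j k then 1 else 0

  module _ (S : PartialSudoku h w) where

    MS : Edge n → Edge n → ℕ
    MS e f = foldT ℕ._+_ 0 n λ i j k →
      if tileInGS S i j k ∧ inTile e i j k ∧ inTile f i j k then 1 else 0

    Mtilde : Edge n → Edge n → ℕ
    Mtilde e f = if inGS S e then (if inGS S f then MS e f else 0) else M e f

    ΔM : Edge n → Edge n → ℤ
    ΔM e f = ℤ.+ (M e f) ℤ.- ℤ.+ (Mtilde e f)

    ΔM𝟏 : Edge n → ℤ
    ΔM𝟏 e = foldE ℤ._+_ (ℤ.+ 0) n λ f → ΔM e f

    u : Edge n → ℕ
    u e = foldT ℕ._+_ 0 n λ i j k →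
      if inTile e i j k ∧ not (tileInGS S i j k) then 1 else 0

    normΔM : ℕ
    normΔM = foldE _⊔_ 0 n λ e → foldE ℕ._+_ 0 n λ f → ℤ.∣ ΔM e f ∣

    normU : ℕ
    normU = foldE _⊔_ 0 n λ e → if inGS S e then u e else 0

-- For e ∈ G_S and any edge f, ΔM(e,f) counts the tiles through e and f that M̃ misses: all of
-- them when f ∉ G_S (then M̃(e,f) = 0), and those outside T(G_S) when f ∈ G_S. Hence ΔM(e,f) ≥ 0.
-- A tile of T(G_S) has all its edges in G_S, so every missed tile through e lies outside T(G_S),
-- is counted by u(e), and is missed for at most its four edges f; thus the row sum of ΔM at e is
-- at most 4 u(e). At a deleted edge e the row of ΔM vanishes because M̃(e,·) = M(e,·), and the
-- norm bound follows by taking maxima.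

module Submission where

open import Defs
open import Data.Nat using (ℕ; NonZero; _*_)
open import Data.Nat as N using ()
open import Data.Integer using (ℤ; +_; _≤_)
open import Data.Bool using (true)
open import Data.Product using (_×_)
open import Relation.Binary.PropositionalEquality using (_≡_)

open import Data.Nat using (zero; suc; _+_; _⊔_; z≤n)
open import Data.Nat.Properties as NP using (module ≤-Reasoning)
import Data.Integer as ℤ
import Data.Integer.Properties as ℤP
open import Algebra.Properties.CommutativeSemigroup NP.+-commutativeSemigroup using (interchange)
open import Algebra.Properties.AbelianGroup ℤP.+-0-abelianGroup using (xyx⁻¹≈y)
open import Data.Fin as Fin using (Fin; toℕ)
open import Data.Bool using (Bool; false; _∧_; _∨_; not; if_then_else_)
open import Data.Bool.Properties using (∨-zeroʳ; ∧-identityʳ)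
open import Data.Product using (_,_)
open import Function using (case_of_)
open import Relation.Nullary using (does)
open import Relation.Binary.PropositionalEquality
  using (refl; sym; trans; cong; cong₂; module ≡-Reasoning)

module _ {A B : Set} (R : A → B → Set) {_∙_ : A → A → A} {ε : A} {_∘_ : B → B → B} {ν : B}
         (R-ε : R ε ν) (R-∙ : ∀ {a b c d} → R a b → R c d → R (a ∙ c) (b ∘ d)) where

  foldFin-pointwise : ∀ n {f : Fin n → A} {g : Fin n → B} →
    (∀ i → R (f i) (g i)) → R (foldFin _∙_ ε n f) (foldFin _∘_ ν n g)
  foldFin-pointwise zero    p = R-ε
  foldFin-pointwise (suc n) p = R-∙ (p Fin.zero) (foldFin-pointwise n (λ i → p (Fin.suc i)))

  foldE-pointwise : ∀ n {f : Edge n → A} {g : Edge n → B} →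
    (∀ e → R (f e) (g e)) → R (foldE _∙_ ε n f) (foldE _∘_ ν n g)
  foldE-pointwise n p = foldFin-pointwise n λ a → foldFin-pointwise n λ b →
    R-∙ (R-∙ (p (rc a b)) (p (rs a b))) (R-∙ (p (cs a b)) (p (bs a b)))

  foldT-pointwise : ∀ n {f : Fin n → Fin n → Fin n → A} {g : Fin n → Fin n → Fin n → B} →
    (∀ i j k → R (f i j k) (g i j k)) → R (foldT _∙_ ε n f) (foldT _∘_ ν n g)
  foldT-pointwise n p =
    foldFin-pointwise n λ i → foldFin-pointwise n λ j → foldFin-pointwise n λ k → p i j k

module _ {A : Set} (P : A → Set) {_∙_ : A → A → A} {ε : A}
         (P-ε : P ε) (P-∙ : ∀ {a b} → P a → P b → P (a ∙ b)) where

  foldE-all : ∀ n {f : Edge n → A} → (∀ e → P (f e)) → P (foldE _∙_ ε n f)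
  foldE-all n {f} = foldE-pointwise (λ a (_ : A) → P a) {_∘_ = _∙_} {ν = ε} P-ε P-∙ n {g = f}

  foldT-all : ∀ n {f : Fin n → Fin n → Fin n → A} → (∀ i j k → P (f i j k)) → P (foldT _∙_ ε n f)
  foldT-all n {f} = foldT-pointwise (λ a (_ : A) → P a) {_∘_ = _∙_} {ν = ε} P-ε P-∙ n {g = f}

module _ {A : Set} (_≼_ : A → A → Set) (≼-trans : ∀ {x y z} → x ≼ y → y ≼ z → x ≼ z)
         (_∙_ : A → A → A) (ε : A)
         (x≼x∙y : ∀ x y → x ≼ (x ∙ y)) (y≼x∙y : ∀ x y → y ≼ (x ∙ y)) where

  foldFin-member : ∀ n (f : Fin n → A) i → f i ≼ foldFin _∙_ ε n f
  foldFin-member (suc n) f Fin.zero    = x≼x∙y _ _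
  foldFin-member (suc n) f (Fin.suc i) =
    ≼-trans (foldFin-member n (λ i → f (Fin.suc i)) i) (y≼x∙y _ _)

  private
    block : ∀ n → (Edge n → A) → Fin n → Fin n → A
    block n f a b = (f (rc a b) ∙ f (rs a b)) ∙ (f (cs a b) ∙ f (bs a b))

    block≼foldE : ∀ n (f : Edge n → A) a b → block n f a b ≼ foldE _∙_ ε n f
    block≼foldE n f a b = ≼-trans (foldFin-member n (block n f a) b)
                                  (foldFin-member n (λ a → foldFin _∙_ ε n (block n f a)) a)

  foldE-member : ∀ n (f : Edge n → A) e → f e ≼ foldE _∙_ ε n f
  foldE-member n f (rc a b) = ≼-trans (≼-trans (x≼x∙y _ _) (x≼x∙y _ _)) (block≼foldE n f a b)
  foldE-member n f (rs a b) = ≼-trans (≼-trans (y≼x∙y _ _) (x≼x∙y _ _)) (block≼foldE n f a b)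
  foldE-member n f (cs a b) = ≼-trans (≼-trans (x≼x∙y _ _) (y≼x∙y _ _)) (block≼foldE n f a b)
  foldE-member n f (bs a b) = ≼-trans (≼-trans (y≼x∙y _ _) (y≼x∙y _ _)) (block≼foldE n f a b)

∨-witness : ∀ n (P : Edge n → Bool) e → P e ≡ true → foldE _∨_ false n P ≡ true
∨-witness = foldE-member (λ x y → x ≡ true → y ≡ true) (λ x⇒y y⇒z → λ x → y⇒z (x⇒y x))
  _∨_ false (λ x y → λ { refl → refl }) (λ x y → λ { refl → ∨-zeroʳ x })

⊔-member : ∀ n (f : Edge n → ℕ) e → f e N.≤ foldE _⊔_ 0 n f
⊔-member = foldE-member N._≤_ NP.≤-trans _⊔_ 0 NP.m≤m⊔n NP.m≤n⊔m

⊔-lub : ∀ n {f : Edge n → ℕ} {m} → (∀ e → f e N.≤ m) → foldE _⊔_ 0 n f N.≤ m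
⊔-lub n {m = m} = foldE-all (N._≤ m) z≤n NP.⊔-lub n

sumE : ∀ n → (Edge n → ℕ) → ℕ
sumE = foldE _+_ 0

sumT : ∀ n → (Fin n → Fin n → Fin n → ℕ) → ℕ
sumT = foldT _+_ 0

sumℕ-cong : ∀ n {f g : Fin n → ℕ} → (∀ i → f i ≡ g i) → sumℕ n f ≡ sumℕ n g
sumℕ-cong = foldFin-pointwise _≡_ refl (cong₂ _+_)

sumE-cong : ∀ n {f g : Edge n → ℕ} → (∀ e → f e ≡ g e) → sumE n f ≡ sumE n g
sumE-cong = foldE-pointwise _≡_ refl (cong₂ _+_)

sumT-cong : ∀ n {f g : Fin n → Fin n → Fin n → ℕ} →
  (∀ i j k → f i j k ≡ g i j k) → sumT n f ≡ sumT n g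
sumT-cong = foldT-pointwise _≡_ refl (cong₂ _+_)

sumE-mono : ∀ n {f g : Edge n → ℕ} → (∀ e → f e N.≤ g e) → sumE n f N.≤ sumE n g
sumE-mono = foldE-pointwise N._≤_ z≤n NP.+-mono-≤

sumT-mono : ∀ n {f g : Fin n → Fin n → Fin n → ℕ} →
  (∀ i j k → f i j k N.≤ g i j k) → sumT n f N.≤ sumT n g
sumT-mono = foldT-pointwise N._≤_ z≤n NP.+-mono-≤

sumℕ-zero : ∀ n → sumℕ n (λ _ → 0) ≡ 0
sumℕ-zero zero    = refl
sumℕ-zero (suc n) = sumℕ-zero n

sumE-zero : ∀ n {f : Edge n → ℕ} → (∀ e → f e ≡ 0) → sumE n f ≡ 0
sumE-zero = foldE-all (_≡ 0) refl (cong₂ _+_)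

sumT-zero : ∀ n → sumT n (λ _ _ _ → 0) ≡ 0
sumT-zero n = foldT-all (_≡ 0) refl (cong₂ _+_) n (λ _ _ _ → refl)

module _ (c : ℕ) where

  private
    R*ˡ R*ʳ : ℕ → ℕ → Set
    R*ˡ x y = x ≡ c * y
    R*ʳ x y = x ≡ y * c

    *ˡ-step : ∀ {a b x y} → R*ˡ a b → R*ˡ x y → R*ˡ (a + x) (b + y)
    *ˡ-step {b = b} {y = y} p q = trans (cong₂ _+_ p q) (sym (NP.*-distribˡ-+ c b y))

    *ʳ-step : ∀ {a b x y} → R*ʳ a b → R*ʳ x y → R*ʳ (a + x) (b + y)
    *ʳ-step {b = b} {y = y} p q = trans (cong₂ _+_ p q) (sym (NP.*-distribʳ-+ c b y))

  sumℕ-*ˡ : ∀ n (f : Fin n → ℕ) → sumℕ n (λ i → c * f i) ≡ c * sumℕ n f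
  sumℕ-*ˡ n f = foldFin-pointwise R*ˡ (sym (NP.*-zeroʳ c))
    (λ {a} {b} {x} {y} → *ˡ-step {a} {b} {x} {y}) n {g = f} (λ _ → refl)

  sumℕ-*ʳ : ∀ n (f : Fin n → ℕ) → sumℕ n (λ i → f i * c) ≡ sumℕ n f * c
  sumℕ-*ʳ n f = foldFin-pointwise R*ʳ refl
    (λ {a} {b} {x} {y} → *ʳ-step {a} {b} {x} {y}) n {g = f} (λ _ → refl)

  sumE-*ʳ : ∀ n (f : Edge n → ℕ) → sumE n (λ e → f e * c) ≡ sumE n f * c
  sumE-*ʳ n f = foldE-pointwise R*ʳ refl
    (λ {a} {b} {x} {y} → *ʳ-step {a} {b} {x} {y}) n {g = f} (λ _ → refl)

  sumT-*ˡ : ∀ n (f : Fin n → Fin n → Fin n → ℕ) →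
    sumT n (λ i j k → c * f i j k) ≡ c * sumT n f
  sumT-*ˡ n f = foldT-pointwise R*ˡ (sym (NP.*-zeroʳ c))
    (λ {a} {b} {x} {y} → *ˡ-step {a} {b} {x} {y}) n {g = f} (λ _ _ _ → refl)

sumℕ-+ : ∀ n (f g : Fin n → ℕ) → sumℕ n (λ i → f i + g i) ≡ sumℕ n f + sumℕ n g
sumℕ-+ zero    f g = refl
sumℕ-+ (suc n) f g =
  trans (cong (_+_ (f Fin.zero + g Fin.zero)) (sumℕ-+ n (λ i → f (Fin.suc i)) (λ i → g (Fin.suc i))))
        (interchange (f Fin.zero) (g Fin.zero) _ _)

sumT-+ : ∀ n (f g : Fin n → Fin n → Fin n → ℕ) →
  sumT n (λ i j k → f i j k + g i j k) ≡ sumT n f + sumT n g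
sumT-+ n f g =
  trans (sumℕ-cong n λ i → trans (sumℕ-cong n λ j → sumℕ-+ n _ _) (sumℕ-+ n _ _)) (sumℕ-+ n _ _)

module Additive {X : Set} (Φ : (X → ℕ) → ℕ)
                (Φ-zero : Φ (λ _ → 0) ≡ 0) (Φ-+ : ∀ f g → Φ (λ x → f x + g x) ≡ Φ f + Φ g) where

  Φ-+₄ : ∀ f g p q → Φ (λ x → (f x + g x) + (p x + q x)) ≡ (Φ f + Φ g) + (Φ p + Φ q)
  Φ-+₄ f g p q = trans (Φ-+ _ _) (cong₂ _+_ (Φ-+ f g) (Φ-+ p q))

  sumℕ-comm : ∀ n (f : Fin n → X → ℕ) → sumℕ n (λ i → Φ (f i)) ≡ Φ (λ x → sumℕ n (λ i → f i x))
  sumℕ-comm zero    f = sym Φ-zero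
  sumℕ-comm (suc n) f =
    trans (cong (_+_ (Φ (f Fin.zero))) (sumℕ-comm n (λ i → f (Fin.suc i)))) (sym (Φ-+ _ _))

module sumℕ-additive n = Additive (sumℕ n) (sumℕ-zero n) (sumℕ-+ n)
module sumT-additive n = Additive {Fin n × Fin n × Fin n}
  (λ t → sumT n λ i j k → t (i , j , k)) (sumT-zero n) (λ f g → sumT-+ n _ _)

sumE-by-kind : ∀ n (f : Edge n → ℕ) → sumE n f ≡
  (sumℕ n (λ a → sumℕ n λ b → f (rc a b)) + sumℕ n (λ a → sumℕ n λ b → f (rs a b)))
  + (sumℕ n (λ a → sumℕ n λ b → f (cs a b)) + sumℕ n (λ a → sumℕ n λ b → f (bs a b)))
sumE-by-kind n f =
  trans (sumℕ-cong n (λ a → sumℕ-additive.Φ-+₄ n _ _ _ _)) (sumℕ-additive.Φ-+₄ n _ _ _ _)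

sumE-comm-sumT : ∀ n (f : Edge n → Fin n → Fin n → Fin n → ℕ) →
  sumE n (λ e → sumT n (f e)) ≡ sumT n (λ i j k → sumE n (λ e → f e i j k))
sumE-comm-sumT n f = begin
  sumE n (λ e → sumT n (f e))
    ≡⟨ sumℕ-cong n (λ a → sumℕ-cong n λ b → sym (sumT-additive.Φ-+₄ n _ _ _ _)) ⟩
  sumℕ n (λ a → sumℕ n λ b → sumT n λ i j k → block a b i j k)
    ≡⟨ sumℕ-cong n (λ a → sumT-additive.sumℕ-comm n n λ b → λ { (i , j , k) → block a b i j k }) ⟩
  sumℕ n (λ a → sumT n λ i j k → sumℕ n λ b → block a b i j k)
    ≡⟨ sumT-additive.sumℕ-comm n n (λ a → λ { (i , j , k) → sumℕ n λ b → block a b i j k }) ⟩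
  sumT n (λ i j k → sumE n (λ e → f e i j k)) ∎
  where
  open ≡-Reasoning
  block : Fin n → Fin n → Fin n → Fin n → Fin n → ℕ
  block a b i j k = (f (rc a b) i j k + f (rs a b) i j k) + (f (cs a b) i j k + f (bs a b) i j k)

𝟙 : Bool → ℕ
𝟙 b = if b then 1 else 0

𝟙-∧ : ∀ a b → 𝟙 (a ∧ b) ≡ 𝟙 a * 𝟙 b
𝟙-∧ false b = refl
𝟙-∧ true  b = sym (NP.*-identityˡ (𝟙 b))

count-eqF : ∀ n (i : Fin n) → sumℕ n (λ a → 𝟙 (eqF a i)) ≡ 1
count-eqF (suc n) Fin.zero    = cong suc (sumℕ-zero n)
count-eqF (suc n) (Fin.suc i) = count-eqF n i

count-toℕ≡≤1 : ∀ n x → sumℕ n (λ a → 𝟙 (does (toℕ a N.≟ x))) N.≤ 1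
count-toℕ≡≤1 zero    x       = z≤n
count-toℕ≡≤1 (suc n) zero    = NP.≤-reflexive (cong suc (sumℕ-zero n))
count-toℕ≡≤1 (suc n) (suc x) = count-toℕ≡≤1 n x

count-pair : ∀ n (p q : Fin n → Bool) →
  sumℕ n (λ a → sumℕ n λ b → 𝟙 (p a ∧ q b)) ≡ sumℕ n (λ a → 𝟙 (p a)) * sumℕ n (λ b → 𝟙 (q b))
count-pair n p q = begin
  sumℕ n (λ a → sumℕ n λ b → 𝟙 (p a ∧ q b))
    ≡⟨ sumℕ-cong n (λ a → sumℕ-cong n λ b → 𝟙-∧ (p a) (q b)) ⟩
  sumℕ n (λ a → sumℕ n λ b → 𝟙 (p a) * 𝟙 (q b))
    ≡⟨ sumℕ-cong n (λ a → sumℕ-*ˡ (𝟙 (p a)) n _) ⟩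
  sumℕ n (λ a → 𝟙 (p a) * sumℕ n (λ b → 𝟙 (q b)))
    ≡⟨ sumℕ-*ʳ _ n _ ⟩
  sumℕ n (λ a → 𝟙 (p a)) * sumℕ n (λ b → 𝟙 (q b)) ∎
  where open ≡-Reasoning

count-pair≤1 : ∀ n (p q : Fin n → Bool) →
  sumℕ n (λ a → 𝟙 (p a)) N.≤ 1 → sumℕ n (λ b → 𝟙 (q b)) N.≤ 1 →
  sumℕ n (λ a → sumℕ n λ b → 𝟙 (p a ∧ q b)) N.≤ 1
count-pair≤1 n p q p≤1 q≤1 = NP.≤-trans (NP.≤-reflexive (count-pair n p q)) (NP.*-mono-≤ p≤1 q≤1)

𝟙-split : ∀ x c d → d ≡ true → 𝟙 x ≡ 𝟙 (c ∧ x) + 𝟙 (x ∧ not (d ∧ c))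
𝟙-split false false _ refl = refl
𝟙-split false true  _ refl = refl
𝟙-split true  false _ refl = refl
𝟙-split true  true  _ refl = refl

𝟙-keep : ∀ x c d → d ≡ false → 𝟙 x ≡ 𝟙 (x ∧ not (d ∧ c))
𝟙-keep x c _ refl = cong 𝟙 (sym (∧-identityʳ x))

𝟙-lost≤ : ∀ a b c d → (c ≡ true → b ≡ true → d ≡ true) →
  𝟙 ((a ∧ b) ∧ not (d ∧ c)) N.≤ 𝟙 b * 𝟙 (a ∧ not c)
𝟙-lost≤ false b     c     d     _ = z≤n
𝟙-lost≤ true  false c     d     _ = z≤n
𝟙-lost≤ true  true  false false _ = NP.≤-refl
𝟙-lost≤ true  true  false true  _ = NP.≤-refl
𝟙-lost≤ true  true  true  true  _ = z≤n
𝟙-lost≤ true  true  true  false d = case d refl refl of λ ()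

module _ (h w : ℕ) .{{_ : NonZero h}} .{{_ : NonZero w}} where

  private
    n : ℕ
    n = h * w

  tileSize≤4 : ∀ i j k → sumE n (λ f → 𝟙 (inTile h w f i j k)) N.≤ 4
  tileSize≤4 i j k = NP.≤-trans (NP.≤-reflexive (sumE-by-kind n (λ f → 𝟙 (inTile h w f i j k))))
    (NP.+-mono-≤ (NP.+-mono-≤ (pair i j) (pair i k)) (NP.+-mono-≤ (pair j k) box-pair))
    where
    box : ℕ
    box = boxℕ h w (toℕ i) (toℕ j)
    single : ∀ i → sumℕ n (λ a → 𝟙 (eqF a i)) N.≤ 1
    single i = NP.≤-reflexive (count-eqF n i)
    pair : ∀ i j → sumℕ n (λ a → sumℕ n λ b → 𝟙 (eqF a i ∧ eqF b j)) N.≤ 1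
    pair i j = count-pair≤1 n (λ a → eqF a i) (λ b → eqF b j) (single i) (single j)
    box-pair : sumℕ n (λ a → sumℕ n λ b → 𝟙 (does (toℕ a N.≟ box) ∧ eqF b k)) N.≤ 1
    box-pair = count-pair≤1 n (λ a → does (toℕ a N.≟ box)) (λ b → eqF b k) (count-toℕ≡≤1 n box) (single k)

  module _ (S : PartialSudoku h w) where

    tileInGS⇒inGS : ∀ {i j k} f →
      tileInGS h w S i j k ≡ true → inTile h w f i j k ≡ true → inGS h w S f ≡ true
    tileInGS⇒inGS {i} {j} {k} f tGS f∈t with deleted h w S f in fDel
    ... | false = refl
    ... | true  = case trans (sym tGS) (cong not someDeleted) of λ ()
      where
      someDeleted : foldE _∨_ false n (λ e → inTile h w e i j k ∧ deleted h w S e) ≡ true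
      someDeleted = ∨-witness n (λ e → inTile h w e i j k ∧ deleted h w S e) f (cong₂ _∧_ f∈t fDel)

    Mtilde-inGS : ∀ e → inGS h w S e ≡ true →
      ∀ f → Mtilde h w S e f ≡ (if inGS h w S f then MS h w S e f else 0)
    Mtilde-inGS e eGS f =
      cong (λ b → if b then (if inGS h w S f then MS h w S e f else 0) else M h w e f) eGS

    Mtilde-deleted : ∀ e → inGS h w S e ≡ false → ∀ f → Mtilde h w S e f ≡ M h w e f
    Mtilde-deleted e eDel f =
      cong (λ b → if b then (if inGS h w S f then MS h w S e f else 0) else M h w e f) eDel

    lostTile : Edge n → Edge n → Fin n → Fin n → Fin n → Bool
    lostTile e f i j k =
      (inTile h w e i j k ∧ inTile h w f i j k) ∧ not (inGS h w S f ∧ tileInGS h w S i j k)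

    lostTiles : Edge n → Edge n → ℕ
    lostTiles e f = sumT n λ i j k → 𝟙 (lostTile e f i j k)

    M≡Mtilde+lostTiles : ∀ e → inGS h w S e ≡ true →
      ∀ f → M h w e f ≡ Mtilde h w S e f + lostTiles e f
    M≡Mtilde+lostTiles e eGS f = by-cases (inGS h w S f) refl
      where
      Mtilde≡ : ∀ {d} → inGS h w S f ≡ d → Mtilde h w S e f ≡ (if d then MS h w S e f else 0)
      Mtilde≡ fGS = trans (Mtilde-inGS e eGS f) (cong (λ b → if b then MS h w S e f else 0) fGS)

      by-cases : ∀ d → inGS h w S f ≡ d → M h w e f ≡ Mtilde h w S e f + lostTiles e f
      by-cases true fGS =
        trans (sumT-cong n λ i j k → 𝟙-split _ (tileInGS h w S i j k) _ fGS)
              (trans (sumT-+ n _ _) (cong (λ m → m + lostTiles e f) (sym (Mtilde≡ fGS))))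
      by-cases false fGS =
        trans (sumT-cong n λ i j k → 𝟙-keep _ (tileInGS h w S i j k) _ fGS)
              (cong (λ m → m + lostTiles e f) (sym (Mtilde≡ fGS)))

    ΔM≡lostTiles : ∀ e → inGS h w S e ≡ true → ∀ f → ΔM h w S e f ≡ + lostTiles e f
    ΔM≡lostTiles e eGS f = begin
      + M h w e f ℤ.- + Mtilde h w S e f
        ≡⟨ cong (λ m → + m ℤ.- + Mtilde h w S e f) (M≡Mtilde+lostTiles e eGS f) ⟩
      + Mtilde h w S e f ℤ.+ + lostTiles e f ℤ.- + Mtilde h w S e f
        ≡⟨ xyx⁻¹≈y (+ Mtilde h w S e f) (+ lostTiles e f) ⟩
      + lostTiles e f ∎
      where open ≡-Reasoning

    ΔM-deleted : ∀ e → inGS h w S e ≡ false → ∀ f → ΔM h w S e f ≡ + 0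
    ΔM-deleted e eDel f =
      trans (cong (λ m → + M h w e f ℤ.- + m) (Mtilde-deleted e eDel f)) (ℤP.+-inverseʳ (+ M h w e f))

    sum-lostTiles≤4u : ∀ e → sumE n (lostTiles e) N.≤ 4 * u h w S e
    sum-lostTiles≤4u e = begin
      sumE n (lostTiles e)
        ≡⟨ sumE-comm-sumT n (λ f i j k → 𝟙 (lostTile e f i j k)) ⟩
      sumT n (λ i j k → sumE n (λ f → 𝟙 (lostTile e f i j k)))
        ≤⟨ sumT-mono n lost-at-tile ⟩
      sumT n (λ i j k → 4 * 𝟙 (outside i j k))
        ≡⟨ sumT-*ˡ 4 n _ ⟩
      4 * u h w S e ∎
      where
      open ≤-Reasoning
      outside : Fin n → Fin n → Fin n → Bool
      outside i j k = inTile h w e i j k ∧ not (tileInGS h w S i j k)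

      lost-at-tile : ∀ i j k → sumE n (λ f → 𝟙 (lostTile e f i j k)) N.≤ 4 * 𝟙 (outside i j k)
      lost-at-tile i j k = begin
        sumE n (λ f → 𝟙 (lostTile e f i j k))
          ≤⟨ sumE-mono n (λ f → 𝟙-lost≤ (inTile h w e i j k) (inTile h w f i j k)
                                        (tileInGS h w S i j k) (inGS h w S f) (tileInGS⇒inGS f)) ⟩
        sumE n (λ f → 𝟙 (inTile h w f i j k) * 𝟙 (outside i j k))
          ≡⟨ sumE-*ʳ (𝟙 (outside i j k)) n (λ f → 𝟙 (inTile h w f i j k)) ⟩
        sumE n (λ f → 𝟙 (inTile h w f i j k)) * 𝟙 (outside i j k)
          ≤⟨ NP.*-monoˡ-≤ (𝟙 (outside i j k)) (tileSize≤4 i j k) ⟩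
        4 * 𝟙 (outside i j k) ∎

    ΔM𝟏≡sum-lostTiles : ∀ e → inGS h w S e ≡ true → ΔM𝟏 h w S e ≡ + sumE n (lostTiles e)
    ΔM𝟏≡sum-lostTiles e eGS =
      foldE-pointwise (λ x y → x ≡ + y) refl (cong₂ ℤ._+_) n (ΔM≡lostTiles e eGS)

    rowSum∣ΔM∣≤ : ∀ e →
      sumE n (λ f → ℤ.∣ ΔM h w S e f ∣) N.≤ 4 * (if inGS h w S e then u h w S e else 0)
    rowSum∣ΔM∣≤ e = by-cases (inGS h w S e) refl
      where
      by-cases : ∀ d → inGS h w S e ≡ d →
        sumE n (λ f → ℤ.∣ ΔM h w S e f ∣) N.≤ 4 * (if d then u h w S e else 0)
      by-cases true  eGS  = NP.≤-trans
        (NP.≤-reflexive (sumE-cong n λ f → cong ℤ.∣_∣ (ΔM≡lostTiles e eGS f))) (sum-lostTiles≤4u e)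
      by-cases false eDel = NP.≤-reflexive (sumE-zero n λ f → cong ℤ.∣_∣ (ΔM-deleted e eDel f))

lemma5p1 : (h w : ℕ) .{{_ : NonZero h}} .{{_ : NonZero w}} → 2 N.≤ h → 2 N.≤ w →
    (S : PartialSudoku h w) →
      ((e : Edge (h * w)) → inGS h w S e ≡ true →
         (+ 0 ≤ ΔM𝟏 h w S e) × (ΔM𝟏 h w S e ≤ + (4 * u h w S e)))
      × (normΔM h w S N.≤ 4 * normU h w S)
lemma5p1 h w _ _ S = rowBounds , normBound
  where
  rowBounds : ∀ e → inGS h w S e ≡ true → (+ 0 ≤ ΔM𝟏 h w S e) × (ΔM𝟏 h w S e ≤ + (4 * u h w S e))
  rowBounds e eGS rewrite ΔM𝟏≡sum-lostTiles h w S e eGS =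
    ℤ.+≤+ z≤n , ℤ.+≤+ (sum-lostTiles≤4u h w S e)
  normBound : normΔM h w S N.≤ 4 * normU h w S
  normBound = ⊔-lub (h * w) λ e → NP.≤-trans (rowSum∣ΔM∣≤ h w S e)
    (NP.*-monoʳ-≤ 4 (⊔-member (h * w) (λ e → if inGS h w S e then u h w S e else 0) e))
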